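{- Let $X\subseteq B^n$. For every $1\le i<j\le n$ such that $X^{[i,j]}$ is not permutation-similar to $X$, we have $w(X^{[i,j]})<w(X)$.
   Context: $B=\{0,1\}$. A comparator $[i,j]$ maps $x\in B^n$ to $x^{[i,j]}$, obtained by replacing $x_i$ by $\min(x_i,x_j)$ and $x_j$ by $\max(x_i,x_j)$; $X^{[i,j]}=\{x^{[i,j]}\mid x\in X\}$. A permutation $\sigma$ of $\{1,\dots,n\}$ acts by $(x^\sigma)_{\sigma(k)}=x_k$; $X$ and $Y$ are permutation-similar if $X=Y^\sigma$ for some $\sigma$. The weight of $X\subseteq B^n$ is $w(X)=\sum_{x,y\in X}\Delta(x,y)$ (sum over ordered pairs), where $\Delta(x,y)=|\{k\mid x_k\neq y_k\}|$ is the Hamming distance. -}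

module Defs where

open import Data.Bool using (Bool; true; false; _∧_; _∨_; _xor_; if_then_else_)
open import Data.Bool.Properties using () renaming (_≟_ to _≟B_)
open import Data.Nat using (ℕ; zero; suc; _+_)
open import Data.Fin using (Fin)
open import Data.Fin.Permutation using (Permutation′; _⟨$⟩ˡ_)
open import Data.Vec using (Vec; []; _∷_; lookup; tabulate; _[_]≔_; zipWith; foldr)
open import Data.Vec.Properties using (≡-dec)
open import Data.Bool.ListAction using (any)
open import Data.List using (List; concatMap) renaming ([] to []ᴸ; _∷_ to _∷ᴸ_)
open import Data.Product using (∃)
open import Relation.Binary.PropositionalEquality using (_≡_)
open import Relation.Nullary.Decidable using (⌊_⌋)

-- B = Bool; a word x ∈ B^n is a Vec Bool n (coordinates indexed by Fin n)
-- A subset X ⊆ B^n is given by its characteristic function (B^n is finite).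
BSet : ℕ → Set
BSet n = Vec Bool n → Bool

_≐_ : ∀ {n} → BSet n → BSet n → Set
X ≐ Y = ∀ v → X v ≡ Y v

allVecs : (n : ℕ) → List (Vec Bool n)
allVecs zero = [] ∷ᴸ []ᴸ
allVecs (suc n) = concatMap (λ v → (false ∷ v) ∷ᴸ (true ∷ v) ∷ᴸ []ᴸ) (allVecs n)

_≟V_ : ∀ {n} (x y : Vec Bool n) → _
_≟V_ = ≡-dec _≟B_

image : ∀ {n} → (Vec Bool n → Vec Bool n) → BSet n → BSet n
image {n} f X y = any (λ x → X x ∧ ⌊ f x ≟V y ⌋) (allVecs n)

comparator : ∀ {n} → Fin n → Fin n → Vec Bool n → Vec Bool n
comparator i j x = (x [ i ]≔ (lookup x i ∧ lookup x j)) [ j ]≔ (lookup x i ∨ lookup x j)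

applyComparator : ∀ {n} → Fin n → Fin n → BSet n → BSet n
applyComparator i j X = image (comparator i j) X

-- Permutation action: (x^σ)_{σ(k)} = x_k, i.e. (x^σ)_m = x_{σ⁻¹(m)}
actVec : ∀ {n} → Permutation′ n → Vec Bool n → Vec Bool n
actVec σ x = tabulate (λ m → lookup x (σ ⟨$⟩ˡ m))

actSet : ∀ {n} → Permutation′ n → BSet n → BSet n
actSet σ Y = image (actVec σ) Y

PermSimilar : ∀ {n} → BSet n → BSet n → Set
PermSimilar X Y = ∃ λ σ → X ≐ actSet σ Y

hamming : ∀ {n} → Vec Bool n → Vec Bool n → ℕ
hamming x y = foldr _ _+_ 0 (zipWith (λ a b → if a xor b then 1 else 0) x y)

sumL : ∀ {A : Set} → (A → ℕ) → List A → ℕ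
sumL f []ᴸ = 0
sumL f (a ∷ᴸ as) = f a + sumL f as

-- Weight: w(X) = Σ_{x,y ∈ X} Δ(x,y) over ordered pairs
weight : ∀ {n} → BSet n → ℕ
weight {n} X =
  sumL (λ x → sumL (λ y → if X x ∧ X y then hamming x y else 0) (allVecs n)) (allVecs n)

-- Sorting the coordinates i, j of two words never increases their Hamming distance, and
-- it strictly decreases it when the pair is out of order in opposite directions in the two
-- words. Passing to the image can only merge points, so w(X^[i,j]) ≤ w(X), strictly as
-- soon as X contains a word with x_i > x_j and a word with y_i < y_j. If X has no word of
-- the first kind the comparator fixes X pointwise; if it has none of the second kind the
-- comparator acts on X as the transposition (i j). Either way X^[i,j] is permutation-similar
-- to X.
module Submission where

open import Defs
open import Data.Nat using (ℕ; zero; suc; _+_; z≤n; s≤s) renaming (_≤_ to _≤ℕ_; _<_ to _<ℕ_)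
open import Data.Nat.Properties
  using (≤-trans; ≤-reflexive; ≤-<-trans; m≤m+n; +-identityʳ; +-assoc; +-monoʳ-≤;
         +-monoʳ-<; +-mono-≤; +-mono-<-≤; +-mono-≤-<; +-cancelʳ-≤; +-cancelʳ-<;
         ≤ᵇ⇒≤; +-commutativeSemigroup; module ≤-Reasoning)
open import Algebra.Properties.CommutativeSemigroup +-commutativeSemigroup
  using (interchange; xy∙z≈zy∙x; xy∙z≈xz∙y; x∙yz≈xz∙y)
open import Data.Fin as Fin using (Fin; _≟_) renaming (_<_ to _<ᶠ_)
open import Data.Fin.Properties using (<⇒≢)
import Data.Fin.Permutation as Perm
open import Data.Fin.Permutation.Components using (transpose)
open import Data.Bool using (Bool; true; false; _∧_; _∨_; _xor_; if_then_else_; _≤_; _<_; b≤b; f≤t; f<t)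
open import Data.Bool.Properties using (∧-idem; ∨-idem; ∧-comm; ∨-comm; ≤-maximum; _<?_) renaming (_≟_ to _≟ᵇ_)
open import Data.Vec using (Vec; []; _∷_; lookup; tabulate; _[_]≔_)
open import Data.Vec.Properties using (lookup∘update; lookup∘update′; []≔-lookup; tabulate∘lookup; tabulate-cong)
open import Data.List using (List; concatMap; _++_) renaming ([] to []ᴸ; _∷_ to _∷ᴸ_)
open import Data.List.Properties using (map-cong)
open import Data.Bool.ListAction using (any; or)
open import Data.List.Relation.Unary.Any using (here; there; any?; satisfied)
import Data.List.Relation.Unary.Any as Any
open import Data.List.Membership.Propositional using (_∈_; lose)
open import Data.List.Membership.Propositional.Properties using (∈-concatMap⁺)
open import Data.Product using (∃; _×_; _,_)
open import Data.Empty using (⊥-elim)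
open import Function using (_∘_)
open import Relation.Nullary using (¬_; Dec; yes; no)
open import Relation.Nullary.Decidable using (⌊_⌋; _×-dec_)
open import Relation.Binary.PropositionalEquality using (_≡_; _≢_; refl; sym; trans; cong; cong₂; module ≡-Reasoning)

private
  variable
    n : ℕ
    A B : Set

mask : Bool → ℕ → ℕ
mask b c = if b then c else 0

mask-mono : ∀ b {c d} → c ≤ℕ d → mask b c ≤ℕ mask b d
mask-mono true  c≤d = c≤d
mask-mono false _   = z≤n

sumL-cong : ∀ {f g : A → ℕ} (xs : List A) → (∀ x → f x ≡ g x) → sumL f xs ≡ sumL g xs
sumL-cong []ᴸ       _   = refl
sumL-cong (x ∷ᴸ xs) f≗g = cong₂ _+_ (f≗g x) (sumL-cong xs f≗g)

sumL-mono : ∀ {f g : A → ℕ} (xs : List A) → (∀ x → f x ≤ℕ g x) → sumL f xs ≤ℕ sumL g xs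
sumL-mono []ᴸ       _   = z≤n
sumL-mono (x ∷ᴸ xs) f≤g = +-mono-≤ (f≤g x) (sumL-mono xs f≤g)

sumL-mono-< : ∀ {f g : A → ℕ} {x} (xs : List A) → (∀ x → f x ≤ℕ g x) → x ∈ xs → f x <ℕ g x →
              sumL f xs <ℕ sumL g xs
sumL-mono-< (_ ∷ᴸ xs) f≤g (here refl) fx<gx = +-mono-<-≤ fx<gx (sumL-mono xs f≤g)
sumL-mono-< (y ∷ᴸ xs) f≤g (there x∈xs) fx<gx = +-mono-≤-< (f≤g y) (sumL-mono-< xs f≤g x∈xs fx<gx)

sumL-zero : (xs : List A) → sumL (λ _ → 0) xs ≡ 0
sumL-zero []ᴸ       = refl
sumL-zero (_ ∷ᴸ xs) = sumL-zero xs

sumL-+ : (f g : A → ℕ) (xs : List A) → sumL (λ x → f x + g x) xs ≡ sumL f xs + sumL g xs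
sumL-+ f g []ᴸ       = refl
sumL-+ f g (x ∷ᴸ xs) = trans (cong (f x + g x +_) (sumL-+ f g xs)) (interchange (f x) (g x) _ _)

sumL-++ : (f : A → ℕ) (xs ys : List A) → sumL f (xs ++ ys) ≡ sumL f xs + sumL f ys
sumL-++ f []ᴸ       ys = refl
sumL-++ f (x ∷ᴸ xs) ys = trans (cong (f x +_) (sumL-++ f xs ys)) (sym (+-assoc (f x) _ _))

sumL-concatMap : (f : B → ℕ) (g : A → List B) (xs : List A) →
                 sumL f (concatMap g xs) ≡ sumL (λ x → sumL f (g x)) xs
sumL-concatMap f g []ᴸ       = refl
sumL-concatMap f g (x ∷ᴸ xs) = trans (sumL-++ f (g x) _) (cong (sumL f (g x) +_) (sumL-concatMap f g xs))

sumL-comm : (g : A → B → ℕ) (xs : List A) (ys : List B) →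
            sumL (λ x → sumL (g x) ys) xs ≡ sumL (λ y → sumL (λ x → g x y) xs) ys
sumL-comm g []ᴸ       ys = sym (sumL-zero ys)
sumL-comm g (x ∷ᴸ xs) ys =
  trans (cong (sumL (g x) ys +_) (sumL-comm g xs ys)) (sym (sumL-+ (g x) _ ys))

sumL-mask-∧ : ∀ a (p : A → Bool) (k : A → ℕ) (xs : List A) →
              sumL (λ x → mask (a ∧ p x) (k x)) xs ≡ mask a (sumL (λ x → mask (p x) (k x)) xs)
sumL-mask-∧ true  p k xs = refl
sumL-mask-∧ false p k xs = sumL-zero xs

mask-any-≤ : ∀ (p : A → Bool) c (xs : List A) → mask (any p xs) c ≤ℕ sumL (λ x → mask (p x) c) xs
mask-any-≤ p c []ᴸ = z≤n
mask-any-≤ p c (x ∷ᴸ xs) with p x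
... | true  = m≤m+n c _
... | false = mask-any-≤ p c xs

∈-allVecs : (v : Vec Bool n) → v ∈ allVecs n
∈-allVecs []          = here refl
∈-allVecs (false ∷ v) = ∈-concatMap⁺ _ (Any.map (λ { refl → here refl }) (∈-allVecs v))
∈-allVecs (true ∷ v)  = ∈-concatMap⁺ _ (Any.map (λ { refl → there (here refl) }) (∈-allVecs v))

does-≟V-∷ : ∀ b c (v u : Vec Bool n) → ⌊ (b ∷ v) ≟V (c ∷ u) ⌋ ≡ ⌊ b ≟ᵇ c ⌋ ∧ ⌊ v ≟V u ⌋
does-≟V-∷ b c v u with b ≟ᵇ c | v ≟V u
... | yes _ | yes _ = refl
... | yes _ | no _  = refl
... | no _  | _     = refl

sumL-allVecs-point : ∀ n (v : Vec Bool n) (h : Vec Bool n → ℕ) →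
                     sumL (λ u → mask ⌊ v ≟V u ⌋ (h u)) (allVecs n) ≡ h v
sumL-allVecs-point zero    []      h = +-identityʳ (h [])
sumL-allVecs-point (suc n) (b ∷ v) h = begin
  sumL (λ u → mask ⌊ (b ∷ v) ≟V u ⌋ (h u)) (allVecs (suc n))
    ≡⟨ sumL-concatMap _ _ (allVecs n) ⟩
  sumL (pair-summand b) (allVecs n)
    ≡⟨ sumL-cong (allVecs n) (pair-summand-≡ b) ⟩
  sumL (λ u → mask ⌊ v ≟V u ⌋ (h (b ∷ u))) (allVecs n)
    ≡⟨ sumL-allVecs-point n v (λ u → h (b ∷ u)) ⟩
  h (b ∷ v) ∎
  where
  open ≡-Reasoning
  pair-summand : Bool → Vec Bool n → ℕ
  pair-summand b u = mask ⌊ (b ∷ v) ≟V (false ∷ u) ⌋ (h (false ∷ u))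
                   + (mask ⌊ (b ∷ v) ≟V (true ∷ u) ⌋ (h (true ∷ u)) + 0)
  pair-summand-≡ : ∀ b u → pair-summand b u ≡ mask ⌊ v ≟V u ⌋ (h (b ∷ u))
  pair-summand-≡ false u rewrite does-≟V-∷ false false v u | does-≟V-∷ false true v u = +-identityʳ _
  pair-summand-≡ true  u rewrite does-≟V-∷ true false v u | does-≟V-∷ true true v u = +-identityʳ _

sumL-image-≤ : ∀ n (f : Vec Bool n → Vec Bool n) (X : BSet n) (h : Vec Bool n → ℕ) →
               sumL (λ u → mask (image f X u) (h u)) (allVecs n)
                 ≤ℕ sumL (λ x → mask (X x) (h (f x))) (allVecs n)
sumL-image-≤ n f X h = begin
  sumL (λ u → mask (image f X u) (h u)) L
    ≤⟨ sumL-mono L (λ u → mask-any-≤ (λ x → X x ∧ ⌊ f x ≟V u ⌋) (h u) L) ⟩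
  sumL (λ u → sumL (λ x → mask (X x ∧ ⌊ f x ≟V u ⌋) (h u)) L) L
    ≡⟨ sumL-comm (λ u x → mask (X x ∧ ⌊ f x ≟V u ⌋) (h u)) L L ⟩
  sumL (λ x → sumL (λ u → mask (X x ∧ ⌊ f x ≟V u ⌋) (h u)) L) L
    ≡⟨ sumL-cong L (λ x → sumL-mask-∧ (X x) (λ u → ⌊ f x ≟V u ⌋) h L) ⟩
  sumL (λ x → mask (X x) (sumL (λ u → mask ⌊ f x ≟V u ⌋ (h u)) L)) L
    ≡⟨ sumL-cong L (λ x → cong (mask (X x)) (sumL-allVecs-point n (f x) h)) ⟩
  sumL (λ x → mask (X x) (h (f x))) L ∎
  where
  open ≤-Reasoning
  L = allVecs n

weight-image-≤ : ∀ n (f : Vec Bool n → Vec Bool n) (X : BSet n) →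
                 weight (image f X)
                   ≤ℕ sumL (λ x → sumL (λ y → mask (X x ∧ X y) (hamming (f x) (f y))) (allVecs n)) (allVecs n)
weight-image-≤ n f X = begin
  weight Y
    ≡⟨ sumL-cong L (λ u → sumL-mask-∧ (Y u) Y (hamming u) L) ⟩
  sumL (λ u → mask (Y u) (sumL (λ v → mask (Y v) (hamming u v)) L)) L
    ≤⟨ sumL-mono L (λ u → mask-mono (Y u) (sumL-image-≤ n f X (hamming u))) ⟩
  sumL (λ u → mask (Y u) (sumL (λ y → mask (X y) (hamming u (f y))) L)) L
    ≤⟨ sumL-image-≤ n f X (λ u → sumL (λ y → mask (X y) (hamming u (f y))) L) ⟩
  sumL (λ x → mask (X x) (sumL (λ y → mask (X y) (hamming (f x) (f y))) L)) L
    ≡⟨ sumL-cong L (λ x → sym (sumL-mask-∧ (X x) X (λ y → hamming (f x) (f y)) L)) ⟩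
  sumL (λ x → sumL (λ y → mask (X x ∧ X y) (hamming (f x) (f y))) L) L ∎
  where
  open ≤-Reasoning
  L = allVecs n
  Y = image f X

weight-image-< : ∀ n (f : Vec Bool n → Vec Bool n) (X : BSet n) →
                 (∀ x y → hamming (f x) (f y) ≤ℕ hamming x y) →
                 ∀ {x₀ y₀} → X x₀ ≡ true → X y₀ ≡ true → hamming (f x₀) (f y₀) <ℕ hamming x₀ y₀ →
                 weight (image f X) <ℕ weight X
weight-image-< n f X nonexpanding {x₀} {y₀} Xx₀ Xy₀ contracted =
  ≤-<-trans (weight-image-≤ n f X)
    (sumL-mono-< L (λ x → sumL-mono L (pair-≤ x)) (∈-allVecs x₀)
      (sumL-mono-< L (pair-≤ x₀) (∈-allVecs y₀) pair-<))
  where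
  L = allVecs n
  pair-≤ : ∀ x y → mask (X x ∧ X y) (hamming (f x) (f y)) ≤ℕ mask (X x ∧ X y) (hamming x y)
  pair-≤ x y = mask-mono (X x ∧ X y) (nonexpanding x y)
  pair-< : mask (X x₀ ∧ X y₀) (hamming (f x₀) (f y₀)) <ℕ mask (X x₀ ∧ X y₀) (hamming x₀ y₀)
  pair-< rewrite Xx₀ | Xy₀ = contracted

image-cong : ∀ n {f g : Vec Bool n → Vec Bool n} (X : BSet n) →
             (∀ x → X x ≡ true → f x ≡ g x) → image f X ≐ image g X
image-cong n {f} {g} X f≗g u = cong or (map-cong agree (allVecs n))
  where
  agree : ∀ x → (X x ∧ ⌊ f x ≟V u ⌋) ≡ (X x ∧ ⌊ g x ≟V u ⌋)
  agree x with X x in Xx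
  ... | false = refl
  ... | true  = cong (λ v → ⌊ v ≟V u ⌋) (f≗g x Xx)

bitDist : Bool → Bool → ℕ
bitDist a b = if a xor b then 1 else 0

hamming-[]≔ : ∀ (k : Fin n) (x y : Vec Bool n) a b →
              hamming (x [ k ]≔ a) (y [ k ]≔ b) + bitDist (lookup x k) (lookup y k)
                ≡ hamming x y + bitDist a b
hamming-[]≔ Fin.zero    (c ∷ x) (d ∷ y) a b = xy∙z≈zy∙x (bitDist a b) (hamming x y) (bitDist c d)
hamming-[]≔ (Fin.suc k) (c ∷ x) (d ∷ y) a b = begin
  bitDist c d + hamming (x [ k ]≔ a) (y [ k ]≔ b) + bitDist (lookup x k) (lookup y k)
    ≡⟨ +-assoc (bitDist c d) _ _ ⟩
  bitDist c d + (hamming (x [ k ]≔ a) (y [ k ]≔ b) + bitDist (lookup x k) (lookup y k))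
    ≡⟨ cong (bitDist c d +_) (hamming-[]≔ k x y a b) ⟩
  bitDist c d + (hamming x y + bitDist a b)
    ≡⟨ +-assoc (bitDist c d) _ _ ⟨
  bitDist c d + hamming x y + bitDist a b ∎
  where open ≡-Reasoning

bitDist-sort₂-≤ : ∀ a b c d → bitDist (a ∧ b) (c ∧ d) + bitDist (a ∨ b) (c ∨ d) ≤ℕ bitDist a c + bitDist b d
bitDist-sort₂-≤ false false false false = ≤ᵇ⇒≤ _ _ _
bitDist-sort₂-≤ false false false true  = ≤ᵇ⇒≤ _ _ _
bitDist-sort₂-≤ false false true  false = ≤ᵇ⇒≤ _ _ _
bitDist-sort₂-≤ false false true  true  = ≤ᵇ⇒≤ _ _ _
bitDist-sort₂-≤ false true  false false = ≤ᵇ⇒≤ _ _ _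
bitDist-sort₂-≤ false true  false true  = ≤ᵇ⇒≤ _ _ _
bitDist-sort₂-≤ false true  true  false = ≤ᵇ⇒≤ _ _ _
bitDist-sort₂-≤ false true  true  true  = ≤ᵇ⇒≤ _ _ _
bitDist-sort₂-≤ true  false false false = ≤ᵇ⇒≤ _ _ _
bitDist-sort₂-≤ true  false false true  = ≤ᵇ⇒≤ _ _ _
bitDist-sort₂-≤ true  false true  false = ≤ᵇ⇒≤ _ _ _
bitDist-sort₂-≤ true  false true  true  = ≤ᵇ⇒≤ _ _ _
bitDist-sort₂-≤ true  true  false false = ≤ᵇ⇒≤ _ _ _
bitDist-sort₂-≤ true  true  false true  = ≤ᵇ⇒≤ _ _ _
bitDist-sort₂-≤ true  true  true  false = ≤ᵇ⇒≤ _ _ _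
bitDist-sort₂-≤ true  true  true  true  = ≤ᵇ⇒≤ _ _ _

bitDist-sort₂-< : ∀ {a b c d} → b < a → c < d →
                  bitDist (a ∧ b) (c ∧ d) + bitDist (a ∨ b) (c ∨ d) <ℕ bitDist a c + bitDist b d
bitDist-sort₂-< f<t f<t = s≤s z≤n

a≤b⇒a∧b≡a : ∀ {a b} → a ≤ b → a ∧ b ≡ a
a≤b⇒a∧b≡a     f≤t = refl
a≤b⇒a∧b≡a {a} b≤b = ∧-idem a

a≤b⇒a∨b≡b : ∀ {a b} → a ≤ b → a ∨ b ≡ b
a≤b⇒a∨b≡b     f≤t = refl
a≤b⇒a∨b≡b {a} b≤b = ∨-idem a

≮⇒≥ : ∀ {a b} → ¬ a < b → b ≤ a
≮⇒≥ {false} {false} _   = b≤b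
≮⇒≥ {false} {true}  a≮b = ⊥-elim (a≮b f<t)
≮⇒≥ {true}  {b}     _   = ≤-maximum b

comparator-sorted : ∀ (i j : Fin n) x → lookup x i ≤ lookup x j → comparator i j x ≡ x
comparator-sorted i j x xi≤xj = begin
  (x [ i ]≔ (lookup x i ∧ lookup x j)) [ j ]≔ (lookup x i ∨ lookup x j)
    ≡⟨ cong₂ (λ a b → (x [ i ]≔ a) [ j ]≔ b) (a≤b⇒a∧b≡a xi≤xj) (a≤b⇒a∨b≡b xi≤xj) ⟩
  (x [ i ]≔ lookup x i) [ j ]≔ lookup x j
    ≡⟨ cong (λ y → y [ j ]≔ lookup x j) ([]≔-lookup x i) ⟩
  x [ j ]≔ lookup x j
    ≡⟨ []≔-lookup x j ⟩
  x ∎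
  where open ≡-Reasoning

module _ {i j : Fin n} (i≢j : i ≢ j) where

  hamming-comparator : ∀ x y →
    hamming (comparator i j x) (comparator i j y)
      + (bitDist (lookup x i) (lookup y i) + bitDist (lookup x j) (lookup y j))
    ≡ hamming x y
      + (bitDist (lookup x i ∧ lookup x j) (lookup y i ∧ lookup y j)
         + bitDist (lookup x i ∨ lookup x j) (lookup y i ∨ lookup y j))
  hamming-comparator x y = begin
    hamming cx cy + (bitDist xi yi + bitDist xj yj)
      ≡⟨ cong (λ d → hamming cx cy + (bitDist xi yi + d)) (cong₂ bitDist (j-untouched x) (j-untouched y)) ⟨
    hamming cx cy + (bitDist xi yi + bitDist (lookup x′ j) (lookup y′ j))
      ≡⟨ x∙yz≈xz∙y (hamming cx cy) _ _ ⟩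
    hamming cx cy + bitDist (lookup x′ j) (lookup y′ j) + bitDist xi yi
      ≡⟨ cong (_+ bitDist xi yi) (hamming-[]≔ j x′ y′ x∨ y∨) ⟩
    hamming x′ y′ + bitDist x∨ y∨ + bitDist xi yi
      ≡⟨ xy∙z≈xz∙y (hamming x′ y′) _ _ ⟩
    hamming x′ y′ + bitDist xi yi + bitDist x∨ y∨
      ≡⟨ cong (_+ bitDist x∨ y∨) (hamming-[]≔ i x y x∧ y∧) ⟩
    hamming x y + bitDist x∧ y∧ + bitDist x∨ y∨
      ≡⟨ +-assoc (hamming x y) _ _ ⟩
    hamming x y + (bitDist x∧ y∧ + bitDist x∨ y∨) ∎
    where
    open ≡-Reasoning
    xi = lookup x i
    xj = lookup x j
    yi = lookup y i
    yj = lookup y j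
    x∧ = xi ∧ xj
    y∧ = yi ∧ yj
    x∨ = xi ∨ xj
    y∨ = yi ∨ yj
    x′ = x [ i ]≔ x∧
    y′ = y [ i ]≔ y∧
    cx = x′ [ j ]≔ x∨
    cy = y′ [ j ]≔ y∨
    j-untouched : ∀ z → lookup (z [ i ]≔ (lookup z i ∧ lookup z j)) j ≡ lookup z j
    j-untouched z = lookup∘update′ (i≢j ∘ sym) z _

  comparator-nonexpanding : ∀ x y → hamming (comparator i j x) (comparator i j y) ≤ℕ hamming x y
  comparator-nonexpanding x y = +-cancelʳ-≤ _ _ _
    (≤-trans (≤-reflexive (hamming-comparator x y))
             (+-monoʳ-≤ (hamming x y) (bitDist-sort₂-≤ (lookup x i) (lookup x j) (lookup y i) (lookup y j))))

  comparator-contracts : ∀ x y → lookup x j < lookup x i → lookup y i < lookup y j →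
                         hamming (comparator i j x) (comparator i j y) <ℕ hamming x y
  comparator-contracts x y xj<xi yi<yj = +-cancelʳ-< _ _ _
    (≤-<-trans (≤-reflexive (hamming-comparator x y))
               (+-monoʳ-< (hamming x y) (bitDist-sort₂-< xj<xi yi<yj)))

  comparator-reversed : ∀ x → lookup x j ≤ lookup x i → comparator i j x ≡ actVec (Perm.transpose i j) x
  comparator-reversed x xj≤xi = begin
    comparator i j x                              ≡⟨ tabulate∘lookup (comparator i j x) ⟨
    tabulate (lookup (comparator i j x))          ≡⟨ tabulate-cong swapped ⟩
    tabulate (λ m → lookup x (transpose j i m))   ∎
    where
    open ≡-Reasoning
    -- actVec reads x at σ⁻¹(m), and the inverse of Perm.transpose i j is transpose j i.
    swapped : ∀ m → lookup (comparator i j x) m ≡ lookup x (transpose j i m)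
    swapped m with m ≟ j
    ... | yes refl = trans (lookup∘update m (x [ i ]≔ _) _) (trans (∨-comm (lookup x i) _) (a≤b⇒a∨b≡b xj≤xi))
    ... | no m≢j with m ≟ i
    ...   | yes refl = begin
      lookup (comparator m j x) m                   ≡⟨ lookup∘update′ m≢j (x [ m ]≔ _) _ ⟩
      lookup (x [ m ]≔ (lookup x m ∧ lookup x j)) m ≡⟨ lookup∘update m x _ ⟩
      lookup x m ∧ lookup x j                       ≡⟨ ∧-comm (lookup x m) _ ⟩
      lookup x j ∧ lookup x m                       ≡⟨ a≤b⇒a∧b≡a xj≤xi ⟩
      lookup x j                                    ∎
    ...   | no m≢i = trans (lookup∘update′ m≢j (x [ i ]≔ _) _) (lookup∘update′ m≢i x _)

∃-inverted? : (X : BSet n) (i j : Fin n) → Dec (∃ λ x → X x ≡ true × lookup x j < lookup x i)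
∃-inverted? {n} X i j with any? (λ x → (X x ≟ᵇ true) ×-dec (lookup x j <? lookup x i)) (allVecs n)
... | yes found = yes (satisfied found)
... | no none   = no (λ (x , px) → none (lose (∈-allVecs x) px))

mainTheorem19 : (n : ℕ) (X : BSet n) (i j : Fin n) → i <ᶠ j →
                ¬ PermSimilar (applyComparator i j X) X →
                weight (applyComparator i j X) <ℕ weight X
mainTheorem19 n X i j i<j notSimilar with ∃-inverted? X i j | ∃-inverted? X j i
... | no noInversion | _ = ⊥-elim (notSimilar (Perm.id , image-cong n X fixed))
  where
  fixed : ∀ x → X x ≡ true → comparator i j x ≡ actVec Perm.id x
  fixed x Xx = trans (comparator-sorted i j x (≮⇒≥ (λ xj<xi → noInversion (x , Xx , xj<xi))))
                     (sym (tabulate∘lookup x))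
... | yes _ | no noReversal = ⊥-elim (notSimilar (Perm.transpose i j , image-cong n X swapped))
  where
  swapped : ∀ x → X x ≡ true → comparator i j x ≡ actVec (Perm.transpose i j) x
  swapped x Xx = comparator-reversed (<⇒≢ i<j) x (≮⇒≥ (λ xi<xj → noReversal (x , Xx , xi<xj)))
... | yes (x , Xx , xj<xi) | yes (y , Xy , yi<yj) =
  weight-image-< n (comparator i j) X (comparator-nonexpanding i≢j) Xx Xy (comparator-contracts i≢j x y xj<xi yi<yj)
  where i≢j = <⇒≢ i<j
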